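{- Let $\mathbf a$ be a sequence over a finite alphabet $\Omega$ and let $k,\ell\ge2$ be multiplicatively dependent integers (i.e. $\log k/\log\ell\in\mathbb Q$). Then $\mathbf a$ is asymptotically $k$-automatic if and only if $\mathbf a$ is asymptotically $\ell$-automatic.
   Context: For a sequence $\mathbf a=(a_n)_{n\ge0}$ and an integer $k\ge2$, the $k$-kernel of $\mathbf a$ is $\mathcal N_k(\mathbf a)=\{(a_{k^in+r})_{n=0}^\infty : i,r\in\mathbb N_0,\ r<k^i\}$. Two sequences $\mathbf a,\mathbf b$ are asymptotically equal, $\mathbf a\simeq\mathbf b$, if $\frac1N\#\{0\le n<N: a_n\ne b_n\}\to0$. A sequence over a finite alphabet is asymptotically $k$-automatic if $\mathcal N_k(\mathbf a)$ is finite up to $\simeq$ (finitely many sequences such that each kernel element is asymptotically equal to one of them). -}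

module Defs where

open import Data.Nat using (ℕ; zero; suc; _+_; _*_; _^_; _≤_; _<_)
open import Data.Fin using (Fin)
open import Data.Fin.Properties using (_≟_)
open import Data.Product using (Σ; ∃; _×_; _,_)
open import Relation.Nullary using (yes; no)

Seq : ℕ → Set
Seq q = ℕ → Fin q

disagree : ∀ {q} → Seq q → Seq q → ℕ → ℕ
disagree a b zero = zero
disagree a b (suc N) with a N ≟ b N
... | yes _ = disagree a b N
... | no  _ = suc (disagree a b N)

-- Asymptotic equality: (1/N) #{n < N : a n ≠ b n} → 0, i.e.
-- for every m there is N₀ such that for all N ≥ N₀ the density is ≤ 1/(m+1).
_≃ₐ_ : ∀ {q} → Seq q → Seq q → Set
a ≃ₐ b = ∀ (m : ℕ) → Σ ℕ λ N₀ → ∀ (N : ℕ) → N₀ ≤ N → suc m * disagree a b N ≤ N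

kernelSeq : ∀ {q} → ℕ → Seq q → ℕ → ℕ → Seq q
kernelSeq k a i r n = a (k ^ i * n + r)

AsympAutomatic : ∀ {q} → ℕ → Seq q → Set
AsympAutomatic {q} k a =
  Σ ℕ λ m → Σ (Fin m → Seq q) λ s →
    ∀ (i r : ℕ) → r < k ^ i → Σ (Fin m) λ j → kernelSeq k a i r ≃ₐ s j

-- k and ℓ are multiplicatively dependent: k^p = ℓ^q for some positive p, q
-- (for k, ℓ ≥ 2 this is equivalent to log k / log ℓ ∈ ℚ).
MultDependent : ℕ → ℕ → Set
MultDependent k l = Σ ℕ λ p → Σ ℕ λ q → (1 ≤ p) × (1 ≤ q) × (k ^ p ≡ l ^ q)
  where open import Relation.Binary.PropositionalEquality using (_≡_)

{-# OPTIONS --safe #-}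
module Submission where

-- Since k ^ p = l ^ q, it suffices to compare k with k ^ p. The (k ^ p)-kernel is part of the
-- k-kernel. Conversely, a k-kernel element of depth i, refined by j ≤ p further digits so that
-- i + j is a multiple of p, splits into k ^ j residue classes that are (k ^ p)-kernel elements,
-- each asymptotically equal to one of the finitely many representatives of the (k ^ p)-kernel.
-- A sequence whose residue classes mod K are asymptotically equal to c₀, …, c_{K-1} is
-- asymptotically equal to their interleaving, and there are only finitely many interleavings of
-- representatives of width k ^ j with j ≤ p.

open import Defs
open import Data.Nat using (ℕ; _≤_)
open import Function.Bundles using (_⇔_; mk⇔)

open import Data.Nat using (zero; suc; _+_; _*_; _^_; _∸_; _⊔_; _<_; z≤n; s≤s; NonZero)
open import Data.Nat.Properties hiding (_≟_)
open import Data.Nat.DivMod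
  using ( _%_; _/_; _mod_; %-congˡ; /-congˡ; m≡m%n+[m/n]*n; [m+kn]%n≡m%n; m<n⇒m%n≡m; m<n⇒m/n≡0
        ; m*n/n≡m; +-distrib-/-∣ʳ; m%n≤n)
open import Data.Nat.Divisibility using (n∣m*n)
open import Data.Fin using (Fin; zero; suc; toℕ; fromℕ<; inject≤; combine; remQuot; finToFun; funToFin)
open import Data.Fin.Properties
  using ( _≟_; toℕ-injective; toℕ-fromℕ<; toℕ-inject≤; toℕ<n; toℕ≤pred[n]
        ; remQuot-combine; finToFun-funToFin)
open import Data.Product using (Σ; _,_; proj₁; proj₂)
open import Function.Base using (_∘_)
open import Function.Properties.Equivalence using () renaming (sym to ⇔-sym; trans to ⇔-trans)
open import Relation.Nullary using (yes; no)
open import Relation.Binary.PropositionalEquality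
open import Algebra.Properties.CommutativeMonoid.Sum +-0-commutativeMonoid
  using (sum; sum-syntax; ∑-distrib-+; sum-cong-≗; sum-replicate-zero)

Eventually : (ℕ → Set) → Set
Eventually P = Σ ℕ λ N₀ → ∀ N → N₀ ≤ N → P N

eventually-∀ : ∀ {K} {P : Fin K → ℕ → Set} →
  (∀ r → Eventually (P r)) → Eventually (λ N → ∀ r → P r N)
eventually-∀ {zero}  h = 0 , λ _ _ ()
eventually-∀ {suc K} h with h zero | eventually-∀ (h ∘ suc)
... | A , P₀ | B , P₊ = A ⊔ B , λ where
  N A⊔B≤N zero    → P₀ N (≤-trans (m≤m⊔n A B) A⊔B≤N)
  N A⊔B≤N (suc r) → P₊ N (≤-trans (m≤n⊔m A B) A⊔B≤N) r

*-sum-≤ : ∀ {K} M N (f : Fin K → ℕ) → (∀ r → M * f r ≤ N) → M * sum f ≤ K * N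
*-sum-≤ {zero}  M N f _ = ≤-reflexive (*-zeroʳ M)
*-sum-≤ {suc K} M N f h = begin
  M * (f zero + sum (f ∘ suc))    ≡⟨ *-distribˡ-+ M (f zero) _ ⟩
  M * f zero + M * sum (f ∘ suc)  ≤⟨ +-mono-≤ (h zero) (*-sum-≤ M N (f ∘ suc) (h ∘ suc)) ⟩
  N + K * N                       ∎
  where open ≤-Reasoning

n<m⇒o<p⇒m*o+n<m*p : ∀ {m n o p} → n < m → o < p → m * o + n < m * p
n<m⇒o<p⇒m*o+n<m*p {m} {n} {o} {p} n<m o<p = begin-strict
  m * o + n  <⟨ +-monoʳ-< (m * o) n<m ⟩
  m * o + m  ≡⟨ +-comm (m * o) m ⟩
  m + m * o  ≡⟨ *-suc m o ⟨
  m * suc o  ≤⟨ *-monoʳ-≤ m o<p ⟩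
  m * p      ∎
  where open ≤-Reasoning

[m*n+o]%m≡o : ∀ m n {o} .{{_ : NonZero m}} → o < m → (m * n + o) % m ≡ o
[m*n+o]%m≡o m n {o} o<m = begin
  (m * n + o) % m  ≡⟨ %-congˡ (trans (+-comm (m * n) o) (cong (o +_) (*-comm m n))) ⟩
  (o + n * m) % m  ≡⟨ [m+kn]%n≡m%n o n m ⟩
  o % m            ≡⟨ m<n⇒m%n≡m o<m ⟩
  o                ∎
  where open ≡-Reasoning

[m*n+o]/m≡n : ∀ m n {o} .{{_ : NonZero m}} → o < m → (m * n + o) / m ≡ n
[m*n+o]/m≡n m n {o} o<m = begin
  (m * n + o) / m    ≡⟨ /-congˡ (trans (+-comm (m * n) o) (cong (o +_) (*-comm m n))) ⟩
  (o + n * m) / m    ≡⟨ +-distrib-/-∣ʳ o (n∣m*n n) ⟩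
  o / m + n * m / m  ≡⟨ cong₂ _+_ (m<n⇒m/n≡0 o<m) (m*n/n≡m n m) ⟩
  n                  ∎
  where open ≡-Reasoning

i+[p∸i%p]≡p*[1+i/p] : ∀ i p .{{_ : NonZero p}} → i + (p ∸ i % p) ≡ p * suc (i / p)
i+[p∸i%p]≡p*[1+i/p] i p = begin
  i + (p ∸ i % p)                    ≡⟨ cong (_+ (p ∸ i % p)) (m≡m%n+[m/n]*n i p) ⟩
  i % p + i / p * p + (p ∸ i % p)    ≡⟨ cong (_+ (p ∸ i % p)) (+-comm (i % p) _) ⟩
  i / p * p + i % p + (p ∸ i % p)    ≡⟨ +-assoc (i / p * p) _ _ ⟩
  i / p * p + (i % p + (p ∸ i % p))  ≡⟨ cong (i / p * p +_) (m+[n∸m]≡n (m%n≤n i p)) ⟩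
  i / p * p + p                      ≡⟨ +-comm (i / p * p) p ⟩
  p + i / p * p                      ≡⟨ cong (p +_) (*-comm (i / p) p) ⟩
  p + p * (i / p)                    ≡⟨ *-suc p (i / p) ⟨
  p * suc (i / p)                    ∎
  where open ≡-Reasoning

pad-to-multiple : ∀ p .{{_ : NonZero p}} i → Σ (Fin (suc p)) λ j → Σ ℕ λ t → i + toℕ j ≡ p * t
pad-to-multiple p i =
  fromℕ< (s≤s (m∸n≤m p (i % p))) , suc (i / p) ,
  trans (cong (i +_) (toℕ-fromℕ< _)) (i+[p∸i%p]≡p*[1+i/p] i p)

mod-toℕ : ∀ {K n} .{{_ : NonZero K}} (r : Fin K) → n % K ≡ toℕ r → n mod K ≡ r
mod-toℕ r n%K≡r = toℕ-injective (trans (toℕ-fromℕ< _) n%K≡r)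

extend-inject≤ : ∀ {A : Set} {K L} .{{_ : NonZero K}} (K≤L : K ≤ L) (f : Fin K → A) →
  Σ (Fin L → A) λ g → ∀ r → g (inject≤ r K≤L) ≡ f r
extend-inject≤ {K = K} K≤L f = (λ y → f (toℕ y mod K)) , λ r →
  cong f (mod-toℕ r (trans (cong (_% K) (toℕ-inject≤ r K≤L)) (m<n⇒m%n≡m (toℕ<n r))))

mismatch : ∀ {q} → Fin q → Fin q → ℕ
mismatch x y with x ≟ y
... | yes _ = 0
... | no  _ = 1

module _ {q : ℕ} where

  disagree-suc : ∀ (a b : Seq q) N → disagree a b (suc N) ≡ disagree a b N + mismatch (a N) (b N)
  disagree-suc a b N with a N ≟ b N
  ... | yes _ = sym (+-identityʳ _)
  ... | no  _ = sym (+-comm _ 1)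

  disagree-cong : ∀ {a a′ b b′ : Seq q} → a ≗ a′ → b ≗ b′ → disagree a b ≗ disagree a′ b′
  disagree-cong a≗a′ b≗b′ zero = refl
  disagree-cong {a} {a′} {b} {b′} a≗a′ b≗b′ (suc N) = begin
    disagree a b (suc N)                    ≡⟨ disagree-suc a b N ⟩
    disagree a b N + mismatch (a N) (b N)
      ≡⟨ cong₂ _+_ (disagree-cong a≗a′ b≗b′ N) (cong₂ mismatch (a≗a′ N) (b≗b′ N)) ⟩
    disagree a′ b′ N + mismatch (a′ N) (b′ N) ≡⟨ disagree-suc a′ b′ N ⟨
    disagree a′ b′ (suc N)                  ∎
    where open ≡-Reasoning

  ≃ₐ-cong : ∀ {a a′ b b′ : Seq q} → a ≗ a′ → b ≗ b′ → a ≃ₐ b → a′ ≃ₐ b′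
  ≃ₐ-cong a≗a′ b≗b′ a≃b m with a≃b m
  ... | N₀ , bound = N₀ , λ N N₀≤N →
    subst (λ d → suc m * d ≤ N) (disagree-cong a≗a′ b≗b′ N) (bound N N₀≤N)

  disagree-+ : ∀ (a b : Seq q) N K →
    disagree a b (N + K) ≡ disagree a b N + ∑[ r < K ] mismatch (a (N + toℕ r)) (b (N + toℕ r))
  disagree-+ a b N zero = trans (cong (disagree a b) (+-identityʳ N)) (sym (+-identityʳ _))
  disagree-+ a b N (suc K) = begin
    disagree a b (N + suc K)                          ≡⟨ cong (disagree a b) (+-suc N K) ⟩
    disagree a b (suc N + K)                          ≡⟨ disagree-+ a b (suc N) K ⟩
    disagree a b (suc N) + ∑[ r < K ] δ (suc N + toℕ r)
      ≡⟨ cong (_+ ∑[ r < K ] δ (suc N + toℕ r)) (disagree-suc a b N) ⟩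
    disagree a b N + δ N + ∑[ r < K ] δ (suc N + toℕ r) ≡⟨ +-assoc (disagree a b N) _ _ ⟩
    disagree a b N + (δ N + ∑[ r < K ] δ (suc N + toℕ r))
      ≡⟨ cong (disagree a b N +_) (cong₂ _+_ (cong δ (sym (+-identityʳ N)))
                                             (sum-cong-≗ {K} λ r → cong δ (sym (+-suc N (toℕ r))))) ⟩
    disagree a b N + ∑[ r < suc K ] δ (N + toℕ r)       ∎
    where
    open ≡-Reasoning
    δ : ℕ → ℕ
    δ n = mismatch (a n) (b n)

  disagree-mono : ∀ (a b : Seq q) {M N} → M ≤ N → disagree a b M ≤ disagree a b N
  disagree-mono a b {M} {N} M≤N = begin
    disagree a b M                 ≤⟨ m≤m+n _ _ ⟩
    disagree a b M + _             ≡⟨ disagree-+ a b M (N ∸ M) ⟨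
    disagree a b (M + (N ∸ M))     ≡⟨ cong (disagree a b) (m+[n∸m]≡n M≤N) ⟩
    disagree a b N                 ∎
    where open ≤-Reasoning

  interleave : (K : ℕ) .{{_ : NonZero K}} → (Fin K → Seq q) → Seq q
  interleave K c n = c (n mod K) (n / K)

  interleave-at : ∀ K .{{_ : NonZero K}} (c : Fin K → Seq q) n r → interleave K c (K * n + toℕ r) ≡ c r n
  interleave-at K c n r =
    cong₂ c (mod-toℕ r ([m*n+o]%m≡o K n (toℕ<n r))) ([m*n+o]/m≡n K n (toℕ<n r))

  disagree-interleave : ∀ K .{{_ : NonZero K}} (b : Seq q) (c : Fin K → Seq q) N →
    disagree b (interleave K c) (K * N) ≡ ∑[ r < K ] disagree (λ n → b (K * n + toℕ r)) (c r) N
  disagree-interleave K b c zero =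
    trans (cong (disagree b (interleave K c)) (*-zeroʳ K)) (sym (sum-replicate-zero K))
  disagree-interleave K b c (suc N) = begin
    disagree b I (K * suc N)   ≡⟨ cong (disagree b I) (trans (*-suc K N) (+-comm K (K * N))) ⟩
    disagree b I (K * N + K)   ≡⟨ disagree-+ b I (K * N) K ⟩
    disagree b I (K * N) + ∑[ r < K ] mismatch (b (K * N + toℕ r)) (I (K * N + toℕ r))
      ≡⟨ cong₂ _+_ (disagree-interleave K b c N)
                   (sum-cong-≗ {K} λ r → cong (mismatch _) (interleave-at K c N r)) ⟩
    ∑[ r < K ] d r N + ∑[ r < K ] mismatch (b (K * N + toℕ r)) (c r N)
      ≡⟨ ∑-distrib-+ (λ r → d r N) _ ⟨
    ∑[ r < K ] (d r N + mismatch (b (K * N + toℕ r)) (c r N))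
      ≡⟨ sum-cong-≗ {K} (λ r → disagree-suc (λ n → b (K * n + toℕ r)) (c r) N) ⟨
    ∑[ r < K ] d r (suc N)     ∎
    where
    open ≡-Reasoning
    I = interleave K c
    d : Fin K → ℕ → ℕ
    d r = disagree (λ n → b (K * n + toℕ r)) (c r)

  -- Each residue class mod K is asked for density at most 1 / (K (m + 1)), so all K together give 1 / (m + 1).
  interleave-≃ₐ : ∀ K .{{_ : NonZero K}} (b : Seq q) (c : Fin K → Seq q) →
    (∀ r → (λ n → b (K * n + toℕ r)) ≃ₐ c r) → b ≃ₐ interleave K c
  interleave-≃ₐ K b c classes≃ m with eventually-∀ (λ r → classes≃ r (K * suc m))
  ... | N₀ , bound = N₀ , λ N N₀≤N → *-cancelˡ-≤ K (begin
    K * (suc m * disagree b I N)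
      ≤⟨ *-monoʳ-≤ K (*-monoʳ-≤ (suc m) (disagree-mono b I (m≤n*m N K))) ⟩
    K * (suc m * disagree b I (K * N))  ≡⟨ cong (λ e → K * (suc m * e)) (disagree-interleave K b c N) ⟩
    K * (suc m * sum (λ r → d r N))     ≡⟨ *-assoc K (suc m) _ ⟨
    K * suc m * sum (λ r → d r N)
      ≤⟨ *-sum-≤ (K * suc m) N _ (λ r → ≤-trans (m≤n+m _ (d r N)) (bound N N₀≤N r)) ⟩
    K * N                               ∎)
    where
    open ≤-Reasoning
    I = interleave K c
    d : Fin K → ℕ → ℕ
    d r = disagree (λ n → b (K * n + toℕ r)) (c r)

  kernelSeq-^ : ∀ (a : Seq q) k p t r → kernelSeq (k ^ p) a t r ≗ kernelSeq k a (p * t) r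
  kernelSeq-^ a k p t r n = cong (λ K → a (K * n + r)) (^-*-assoc k p t)

  kernelSeq-kernelSeq : ∀ (a : Seq q) k i r j r′ →
    kernelSeq k (kernelSeq k a i r) j r′ ≗ kernelSeq k a (i + j) (k ^ i * r′ + r)
  kernelSeq-kernelSeq a k i r j r′ n = cong a (begin
    k ^ i * (k ^ j * n + r′) + r          ≡⟨ cong (_+ r) (*-distribˡ-+ (k ^ i) (k ^ j * n) r′) ⟩
    k ^ i * (k ^ j * n) + k ^ i * r′ + r  ≡⟨ +-assoc (k ^ i * (k ^ j * n)) _ r ⟩
    k ^ i * (k ^ j * n) + (k ^ i * r′ + r) ≡⟨ cong (_+ (k ^ i * r′ + r)) (*-assoc (k ^ i) (k ^ j) n) ⟨
    k ^ i * k ^ j * n + (k ^ i * r′ + r)   ≡⟨ cong (λ K → K * n + (k ^ i * r′ + r)) (^-distribˡ-+-* k i j) ⟨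
    k ^ (i + j) * n + (k ^ i * r′ + r)     ∎)
    where open ≡-Reasoning

  kernelSeq-≃-interleave : ∀ (a : Seq q) k .{{_ : NonZero k}} {m} (s : Fin m → Seq q) i j r → r < k ^ i →
    (∀ r′ → r′ < k ^ (i + j) → Σ (Fin m) λ x → kernelSeq k a (i + j) r′ ≃ₐ s x) →
    Σ (Fin (k ^ j) → Fin m) λ choice →
      kernelSeq k a i r ≃ₐ interleave (k ^ j) {{m^n≢0 k j}} (s ∘ choice)
  kernelSeq-≃-interleave a k {m} s i j r r<kⁱ cover = choice , interleave-≃ₐ (k ^ j) _ _ λ r′ →
    ≃ₐ-cong (λ n → sym (kernelSeq-kernelSeq a k i r j (toℕ r′) n)) (λ _ → refl)
            (proj₂ (cover _ (offset< r′)))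
    where
    instance
      k^j-nonZero : NonZero (k ^ j)
      k^j-nonZero = m^n≢0 k j

    offset< : ∀ (r′ : Fin (k ^ j)) → k ^ i * toℕ r′ + r < k ^ (i + j)
    offset< r′ = subst (k ^ i * toℕ r′ + r <_) (sym (^-distribˡ-+-* k i j))
      (n<m⇒o<p⇒m*o+n<m*p r<kⁱ (toℕ<n r′))

    choice : Fin (k ^ j) → Fin m
    choice r′ = proj₁ (cover _ (offset< r′))

  AsympAutomatic⇒AsympAutomatic-^ : ∀ (a : Seq q) k p → AsympAutomatic k a → AsympAutomatic (k ^ p) a
  AsympAutomatic⇒AsympAutomatic-^ a k p (m , s , cover) = m , s , λ t r r<kᵖᵗ →
    let x , kernel≃s = cover (p * t) r (subst (r <_) (^-*-assoc k p t) r<kᵖᵗ)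
    in x , ≃ₐ-cong (λ n → sym (kernelSeq-^ a k p t r n)) (λ _ → refl) kernel≃s

  AsympAutomatic-^⇒AsympAutomatic : ∀ (a : Seq q) k p .{{_ : NonZero k}} .{{_ : NonZero p}} →
    AsympAutomatic (k ^ p) a → AsympAutomatic k a
  AsympAutomatic-^⇒AsympAutomatic a k p (m , s , cover) =
    suc p * m ^ k ^ p , interleavings , kernel≃interleavings
    where
    CoveredAt : ℕ → Set
    CoveredAt d = ∀ r → r < k ^ d → Σ (Fin m) λ x → kernelSeq k a d r ≃ₐ s x

    coverᵖ : ∀ t → CoveredAt (p * t)
    coverᵖ t r r<kᵖᵗ =
      let x , kernel≃s = cover t r (subst (r <_) (sym (^-*-assoc k p t)) r<kᵖᵗ)
      in x , ≃ₐ-cong (kernelSeq-^ a k p t r) (λ _ → refl) kernel≃s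

    interleaving : Fin (suc p) → (Fin (k ^ p) → Fin m) → Seq q
    interleaving j v = interleave (k ^ toℕ j) {{m^n≢0 k (toℕ j)}}
      (λ r′ → s (v (inject≤ r′ (^-monoʳ-≤ k (toℕ≤pred[n] j)))))

    interleavings : Fin (suc p * m ^ k ^ p) → Seq q
    interleavings x = let j , w = remQuot {suc p} (m ^ k ^ p) x in interleaving j (finToFun w)

    interleavings-combine : ∀ j v → interleavings (combine j (funToFin v)) ≗ interleaving j v
    interleavings-combine j v n = trans
      (cong (λ (jw : Σ _ _) → interleaving (proj₁ jw) (finToFun (proj₂ jw)) n)
            (remQuot-combine {suc p} {m ^ k ^ p} j (funToFin v)))
      (cong (λ y → s y _) (finToFun-funToFin v _))

    kernel≃interleavings : ∀ i r → r < k ^ i →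
      Σ (Fin (suc p * m ^ k ^ p)) λ x → kernelSeq k a i r ≃ₐ interleavings x
    kernel≃interleavings i r r<kⁱ with pad-to-multiple p i
    ... | j , t , i+j≡pt with kernelSeq-≃-interleave a k s i (toℕ j) r r<kⁱ
                                (subst CoveredAt (sym i+j≡pt) (coverᵖ t))
    ... | choice , kernel≃interleave
      with extend-inject≤ {{m^n≢0 k (toℕ j)}} (^-monoʳ-≤ k (toℕ≤pred[n] j)) choice
    ... | v , v-extends = combine j (funToFin v) ,
      ≃ₐ-cong (λ _ → refl)
              (λ n → sym (trans (interleavings-combine j v n) (cong (λ y → s y _) (v-extends _))))
              kernel≃interleave

  AsympAutomatic⇔AsympAutomatic-^ : ∀ (a : Seq q) k p .{{_ : NonZero k}} .{{_ : NonZero p}} →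
    AsympAutomatic k a ⇔ AsympAutomatic (k ^ p) a
  AsympAutomatic⇔AsympAutomatic-^ a k p =
    mk⇔ (AsympAutomatic⇒AsympAutomatic-^ a k p) (AsympAutomatic-^⇒AsympAutomatic a k p)

lemma3p1 : ∀ {q : ℕ} (a : Seq q) (k l : ℕ) → 2 ≤ k → 2 ≤ l → MultDependent k l →
    AsympAutomatic k a ⇔ AsympAutomatic l a
lemma3p1 a k l (s≤s (s≤s _)) (s≤s (s≤s _)) (p , p′ , s≤s z≤n , s≤s z≤n , kᵖ≡lᵖ′) =
  ⇔-trans (AsympAutomatic⇔AsympAutomatic-^ a k p)
    (subst (λ n → AsympAutomatic n a ⇔ AsympAutomatic l a) (sym kᵖ≡lᵖ′)
      (⇔-sym (AsympAutomatic⇔AsympAutomatic-^ a l p′)))
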